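{- Let $G$ and $H$ be connected graphs. Then $(G\Box H)_{SR}\cong G_{SR}\times H_{SR}$.
   Context: All graphs are finite and simple. For a connected graph $G$, $d_G$ denotes the shortest-path distance. A vertex $u$ is maximally distant from a vertex $v$ if $d_G(v,w)\le d_G(u,v)$ for every neighbor $w$ of $u$; $u$ and $v$ are mutually maximally distant if each is maximally distant from the other. The boundary $\partial(G)$ is the set of vertices $u$ for which some vertex $v$ exists such that $u,v$ are mutually maximally distant. The strong resolving graph $G_{SR}$ has vertex set $\partial(G)$, two vertices being adjacent iff they are mutually maximally distant in $G$. The Cartesian product $G\Box H$ has vertex set $V(G)\times V(H)$, with $(a,b)\sim(c,d)$ iff ($a=c$ and $bd\in E(H)$) or ($b=d$ and $ac\in E(G)$). The direct product $G\times H$ has vertex set $V(G)\times V(H)$, with $(a,b)\sim(c,d)$ iff $ac\in E(G)$ and $bd\in E(H)$. -}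

module Defs where

open import Data.Nat using (ℕ; zero; suc; _≤_)
open import Data.Fin using (Fin)
open import Data.Product using (Σ; ∃; _×_; _,_)
open import Data.Sum using (_⊎_; inj₁; inj₂)
open import Relation.Nullary using (¬_)
open import Relation.Binary.PropositionalEquality using (_≡_; refl)
open import Function.Bundles using (_↔_; _⇔_)

record Graph : Set₁ where
  field
    V     : Set
    Adj   : V → V → Set
    sym   : ∀ {u v} → Adj u v → Adj v u
    irrefl : ∀ {u} → ¬ Adj u u

open Graph public

Finite : Graph → Set
Finite G = Σ ℕ λ n → V G ↔ Fin n

data Walk (G : Graph) : V G → V G → ℕ → Set where
  here : ∀ {u} → Walk G u u zero
  step : ∀ {u w v k} → Adj G u w → Walk G w v k → Walk G u v (suc k)

Connected : Graph → Set
Connected G = ∀ u v → Σ ℕ λ k → Walk G u v k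

Dist : (G : Graph) → V G → V G → ℕ → Set
Dist G u v k = Walk G u v k × (∀ m → Walk G u v m → k ≤ m)

MaxDist : (G : Graph) → V G → V G → Set
MaxDist G u v = ∀ w → Adj G u w → ∀ k l → Dist G v w k → Dist G u v l → k ≤ l

MMD : (G : Graph) → V G → V G → Set
MMD G u v = MaxDist G u v × MaxDist G v u

Boundary : (G : Graph) → V G → Set
Boundary G u = ∃ λ v → MMD G u v

□Adj : (G H : Graph) → V G × V H → V G × V H → Set
□Adj G H (a , b) (c , d) = (a ≡ c × Adj H b d) ⊎ (b ≡ d × Adj G a c)

□sym : (G H : Graph) → ∀ {u v} → □Adj G H u v → □Adj G H v u
□sym G H {a , b} {.a , d} (inj₁ (refl , e)) = inj₁ (refl , Graph.sym H e)
□sym G H {a , b} {c , .b} (inj₂ (refl , e)) = inj₂ (refl , Graph.sym G e)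

□irr : (G H : Graph) → ∀ {u} → ¬ □Adj G H u u
□irr G H (inj₁ (_ , e)) = Graph.irrefl H e
□irr G H (inj₂ (_ , e)) = Graph.irrefl G e

_□_ : Graph → Graph → Graph
G □ H = record { V = V G × V H ; Adj = □Adj G H ; sym = □sym G H ; irrefl = □irr G H }

-- A graph whose vertex set is the subset {x | In x} of a carrier type.
record SubGraph : Set₁ where
  field
    Car  : Set
    In   : Car → Set
    SAdj : Car → Car → Set

open SubGraph public

SR : Graph → SubGraph
SR G = record { Car = V G ; In = Boundary G ; SAdj = MMD G }

_⊗_ : SubGraph → SubGraph → SubGraph
A ⊗ B = record
  { Car = Car A × Car B
  ; In = λ { (a , b) → In A a × In B b }
  ; SAdj = λ { (a , b) (c , d) → SAdj A a c × SAdj B b d }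
  }

record _≅_ (A B : SubGraph) : Set where
  field
    to      : Car A → Car B
    from    : Car B → Car A
    to-in   : ∀ {x} → In A x → In B (to x)
    from-in : ∀ {y} → In B y → In A (from y)
    from-to : ∀ {x} → In A x → from (to x) ≡ x
    to-from : ∀ {y} → In B y → to (from y) ≡ y
    adj     : ∀ {x x'} → In A x → In A x' → SAdj A x x' ⇔ SAdj B (to x) (to x')

module Submission where

-- Distances in G □ H add up coordinatewise, and a neighbour of (a , b) changes exactly one
-- coordinate.  Hence (a , b) is maximally distant from (c , d) in G □ H iff a is maximally
-- distant from c in G and b from d in H, so the identity map on V G × V H is the isomorphism.
-- Distances need not be computable here (adjacency is not decidable), but every claim about
-- them is an inequality of naturals, hence stable under double negation.

open import Defs
open import Data.Nat using (ℕ; suc; _+_; _≤_; _<_; _≤?_)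
open import Data.Nat.Properties using (≤-antisym; ≤-reflexive; ≰⇒>; +-suc; +-mono-≤; +-cancelˡ-≤; +-cancelʳ-≤)
open import Data.Nat.Induction using (<-rec)
open import Data.Product using (Σ; _×_; _,_; proj₂)
open import Data.Sum using (inj₁; inj₂)
open import Relation.Nullary using (¬_)
open import Relation.Nullary.Decidable using (decidable-stable)
open import Relation.Nullary.Negation using (¬¬-map)
open import Relation.Binary.PropositionalEquality using (_≡_; refl; trans; cong)
open import Function.Bundles using (mk⇔)

module _ {X : Graph} where

  _++ʷ_ : ∀ {u v w k l} → Walk X u v k → Walk X v w l → Walk X u w (k + l)
  here     ++ʷ q = q
  step e p ++ʷ q = step e (p ++ʷ q)

  snocʷ : ∀ {u v w k} → Walk X u v k → Adj X v w → Walk X u w (suc k)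
  snocʷ here       e = step e here
  snocʷ (step f p) e = step f (snocʷ p e)

  reverseʷ : ∀ {u v k} → Walk X u v k → Walk X v u k
  reverseʷ here       = here
  reverseʷ (step e p) = snocʷ (reverseʷ p) (Graph.sym X e)

  Dist-sym : ∀ {u v k} → Dist X u v k → Dist X v u k
  Dist-sym (p , minimal) = reverseʷ p , λ m q → minimal m (reverseʷ q)

  Dist-unique : ∀ {u v k l} → Dist X u v k → Dist X u v l → k ≡ l
  Dist-unique (p , p-shortest) (q , q-shortest) = ≤-antisym (p-shortest _ q) (q-shortest _ p)

  walk⇒¬¬Dist : ∀ {u v n} → Walk X u v n → ¬ ¬ Σ ℕ (Dist X u v)
  walk⇒¬¬Dist {u} {v} {n} p noDist = <-rec (λ n → ¬ Walk X u v n) noShortest n p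
    where
    noShortest : ∀ n → (∀ {m} → m < n → ¬ Walk X u v m) → ¬ Walk X u v n
    noShortest n noShorter p = noDist (n , p , λ m q →
      decidable-stable (n ≤? m) (λ n≰m → noShorter (≰⇒> n≰m) q))

module _ {G H : Graph} where

  private
    GH = G □ H

  □-walk-split : ∀ {a b c d n} → Walk GH (a , b) (c , d) n →
    Σ ℕ λ k → Σ ℕ λ l → Walk G a c k × Walk H b d l × k + l ≡ n
  □-walk-split here = 0 , 0 , here , here , refl
  □-walk-split (step (inj₁ (refl , e)) p) with □-walk-split p
  ... | k , l , p₁ , p₂ , k+l≡n = k , _ , p₁ , step e p₂ , trans (+-suc k l) (cong suc k+l≡n)
  □-walk-split (step (inj₂ (refl , e)) p) with □-walk-split p
  ... | k , l , p₁ , p₂ , k+l≡n = _ , l , step e p₁ , p₂ , cong suc k+l≡n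

  □-walkˡ : ∀ {a c b k} → Walk G a c k → Walk GH (a , b) (c , b) k
  □-walkˡ here       = here
  □-walkˡ (step e p) = step (inj₂ (refl , e)) (□-walkˡ p)

  □-walkʳ : ∀ {a b d l} → Walk H b d l → Walk GH (a , b) (a , d) l
  □-walkʳ here       = here
  □-walkʳ (step e p) = step (inj₁ (refl , e)) (□-walkʳ p)

  □-walk : ∀ {a b c d k l} → Walk G a c k → Walk H b d l → Walk GH (a , b) (c , d) (k + l)
  □-walk p q = □-walkˡ p ++ʷ □-walkʳ q

  □-Dist : ∀ {a b c d k l} → Dist G a c k → Dist H b d l → Dist GH (a , b) (c , d) (k + l)
  □-Dist {a} {b} {c} {d} {k} {l} (p , p-shortest) (q , q-shortest) = □-walk p q , shortest
    where
    shortest : ∀ m → Walk GH (a , b) (c , d) m → k + l ≤ m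
    shortest m r with □-walk-split r
    ... | k′ , l′ , p′ , q′ , refl = +-mono-≤ (p-shortest k′ p′) (q-shortest l′ q′)

  □-Dist-split : ∀ {a b c d n} → Dist GH (a , b) (c , d) n →
    Σ ℕ λ k → Σ ℕ λ l → Dist G a c k × Dist H b d l × k + l ≡ n
  □-Dist-split (r , r-shortest) with □-walk-split r
  ... | k , l , p , q , refl =
    k , l ,
    (p , λ m p′ → +-cancelʳ-≤ l k m (r-shortest _ (□-walk p′ q))) ,
    (q , λ m q′ → +-cancelˡ-≤ k l m (r-shortest _ (□-walk p q′))) ,
    refl

  -- Compare the G-neighbour (a′ , b) of (a , b) with (c , d) through a shortest d–b path in H.
  □-MaxDist⇒MaxDistˡ : ∀ {a b c d} → Connected H → MaxDist GH (a , b) (c , d) → MaxDist G a c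
  □-MaxDist⇒MaxDistˡ {a} {b} {c} {d} connH maxDist a′ e k l dₖ dₗ =
    decidable-stable (k ≤? l) (¬¬-map cancel (walk⇒¬¬Dist (proj₂ (connH d b))))
    where
    cancel : Σ ℕ (Dist H d b) → k ≤ l
    cancel (m , dₘ) = +-cancelʳ-≤ m k l
      (maxDist (a′ , b) (inj₂ (refl , e)) (k + m) (l + m) (□-Dist dₖ dₘ) (□-Dist dₗ (Dist-sym dₘ)))

  □-MaxDist⇒MaxDistʳ : ∀ {a b c d} → Connected G → MaxDist GH (a , b) (c , d) → MaxDist H b d
  □-MaxDist⇒MaxDistʳ {a} {b} {c} {d} connG maxDist b′ e k l dₖ dₗ =
    decidable-stable (k ≤? l) (¬¬-map cancel (walk⇒¬¬Dist (proj₂ (connG a c))))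
    where
    cancel : Σ ℕ (Dist G a c) → k ≤ l
    cancel (m , dₘ) = +-cancelˡ-≤ m k l
      (maxDist (a , b′) (inj₁ (refl , e)) (m + k) (m + l) (□-Dist (Dist-sym dₘ) dₖ) (□-Dist dₘ dₗ))

  MaxDist-□ : ∀ {a b c d} → MaxDist G a c → MaxDist H b d → MaxDist GH (a , b) (c , d)
  MaxDist-□ maxG maxH (_ , b′) (inj₁ (refl , e)) _ _ dₖ dₗ
    with □-Dist-split dₖ | □-Dist-split dₗ
  ... | k₁ , k₂ , dₖ₁ , dₖ₂ , refl | l₁ , l₂ , dₗ₁ , dₗ₂ , refl =
    +-mono-≤ (≤-reflexive (Dist-unique dₖ₁ (Dist-sym dₗ₁))) (maxH b′ e k₂ l₂ dₖ₂ dₗ₂)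
  MaxDist-□ maxG maxH (a′ , _) (inj₂ (refl , e)) _ _ dₖ dₗ
    with □-Dist-split dₖ | □-Dist-split dₗ
  ... | k₁ , k₂ , dₖ₁ , dₖ₂ , refl | l₁ , l₂ , dₗ₁ , dₗ₂ , refl =
    +-mono-≤ (maxG a′ e k₁ l₁ dₖ₁ dₗ₁) (≤-reflexive (Dist-unique dₖ₂ (Dist-sym dₗ₂)))

  □-MMD⇒MMD : ∀ {a b c d} → Connected G → Connected H →
    MMD GH (a , b) (c , d) → MMD G a c × MMD H b d
  □-MMD⇒MMD connG connH (max₁ , max₂) =
    (□-MaxDist⇒MaxDistˡ connH max₁ , □-MaxDist⇒MaxDistˡ connH max₂) ,
    (□-MaxDist⇒MaxDistʳ connG max₁ , □-MaxDist⇒MaxDistʳ connG max₂)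

  MMD⇒□-MMD : ∀ {a b c d} → MMD G a c × MMD H b d → MMD GH (a , b) (c , d)
  MMD⇒□-MMD ((maxG₁ , maxG₂) , (maxH₁ , maxH₂)) = MaxDist-□ maxG₁ maxH₁ , MaxDist-□ maxG₂ maxH₂

  □-Boundary⇒Boundary : ∀ {a b} → Connected G → Connected H →
    Boundary GH (a , b) → Boundary G a × Boundary H b
  □-Boundary⇒Boundary connG connH ((c , d) , mmd) =
    let mmdG , mmdH = □-MMD⇒MMD connG connH mmd in (c , mmdG) , (d , mmdH)

  Boundary⇒□-Boundary : ∀ {a b} → Boundary G a × Boundary H b → Boundary GH (a , b)
  Boundary⇒□-Boundary ((c , mmdG) , (d , mmdH)) = (c , d) , MMD⇒□-MMD (mmdG , mmdH)

theorem3 : (G H : Graph) → Finite G → Finite H → Connected G → Connected H →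
    SR (G □ H) ≅ (SR G ⊗ SR H)
theorem3 G H _ _ connG connH = record
  { to      = λ x → x
  ; from    = λ y → y
  ; to-in   = □-Boundary⇒Boundary connG connH
  ; from-in = Boundary⇒□-Boundary
  ; from-to = λ _ → refl
  ; to-from = λ _ → refl
  ; adj     = λ _ _ → mk⇔ (□-MMD⇒MMD connG connH) MMD⇒□-MMD
  }
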